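{- Let $d \geq 4$. Let $a,b,c$ be the lengths given by: if $d\equiv 0 \pmod 3$, $a=b=c=d/3$; if $d\equiv 1\pmod 3$, $a=\lceil d/3\rceil$, $b=c=\lfloor d/3\rfloor$; if $d\equiv 2\pmod 3$, $a=b=\lceil d/3\rceil$, $c=\lfloor d/3\rfloor$. Let $\alpha,\beta,\gamma$ be strings of $0$'s of lengths $a,b,c$ and $\bar\alpha,\bar\beta,\bar\gamma$ strings of $1$'s of the same lengths, and define the vertices of $C^d$ (by concatenation) $v_1=\alpha\beta\gamma$, $v_2=\bar\alpha\bar\beta\gamma$, $v_3=\alpha\bar\beta\bar\gamma$, $v_4=\bar\alpha\beta\bar\gamma$. Then every ridge of $C^d$ belongs to at most two of the asterisk sets $Ast(v_1),\dots,Ast(v_4)$; the number of ridges belonging to exactly two of them is $\frac{1}{3}d(d-3)$ if $d\equiv 0 \pmod 3$ and $\frac13(d-1)(d-2)$ if $d\equiv 1,2\pmod 3$; and this number equals the number of ridges of $C^d$ belonging to none of $Ast(v_1),\dots,Ast(v_4)$.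
   Context: $C^d=[0,1]^d$; its vertices are the points of $\{0,1\}^d$. A $k$-face of $C^d$ is given by a word in $\{0,1,X\}^d$ with exactly $k$ letters $X$ (the set of points agreeing with the word in the non-$X$ positions). A ridge is a $(d-2)$-face; $C^d$ has $4\binom{d}{2}$ ridges. For a vertex $v$, the asterisk set $Ast(v)$ is the set of all ridges containing $v$ (the $\binom{d}{2}$ ridges obtained from $v$ by replacing $d-2$ of its coordinates by $X$). -}

module Defs where

open import Data.Nat using (ℕ; zero; suc; _+_; _*_; _<ᵇ_; _≡ᵇ_)
open import Data.Nat.DivMod using (_/_; _%_)
open import Data.Bool using (Bool; true; false; _∧_; if_then_else_)
open import Data.Fin using (Fin; toℕ)
open import Data.Vec using (Vec; []; _∷_; tabulate)
open import Data.List using (List; []; _∷_; map; concatMap; filter; length; sum)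
open import Relation.Nullary.Decidable using (Dec)
open import Relation.Binary.PropositionalEquality using (_≡_)
open import Data.Nat using (_≟_)
open import Data.Bool.Properties using (T?)

data Letter : Set where
  𝟎 𝟏 X : Letter

-- A face of C^d is a word in {0,1,X}^d
Word : ℕ → Set
Word d = Vec Letter d

-- A vertex of C^d is a point of {0,1}^d (false = 0, true = 1)
Vertex : ℕ → Set
Vertex d = Vec Bool d

allWords : (d : ℕ) → List (Word d)
allWords zero = [] ∷ []
allWords (suc d) = concatMap (λ w → (𝟎 ∷ w) ∷ (𝟏 ∷ w) ∷ (X ∷ w) ∷ []) (allWords d)

numX : ∀ {d} → Word d → ℕ
numX [] = 0
numX (X ∷ w) = suc (numX w)
numX (_ ∷ w) = numX w

-- the face given by w is a ridge ((d-2)-face) iff it has exactly d-2 letters X,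
-- i.e. exactly two non-X letters
numFixed : ∀ {d} → Word d → ℕ
numFixed [] = 0
numFixed (X ∷ w) = numFixed w
numFixed (_ ∷ w) = suc (numFixed w)

isRidge : ∀ {d} → Word d → Bool
isRidge w = numFixed w ≡ᵇ 2

contains : ∀ {d} → Word d → Vertex d → Bool
contains [] [] = true
contains (X ∷ w) (_ ∷ v) = contains w v
contains (𝟎 ∷ w) (false ∷ v) = contains w v
contains (𝟏 ∷ w) (true ∷ v) = contains w v
contains (_ ∷ w) (_ ∷ v) = false

-- r ∈ Ast(v): r is a ridge containing v
inAst : ∀ {d} → Vertex d → Word d → Bool
inAst v r = isRidge r ∧ contains r v

ridges : (d : ℕ) → List (Word d)
ridges d = filter (λ r → T? (isRidge r)) (allWords d)

lenA lenB lenC : ℕ → ℕ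
lenA d with d % 3
... | 0 = d / 3
... | _ = suc (d / 3)
lenB d with d % 3
... | 2 = suc (d / 3)
... | _ = d / 3
lenC d = d / 3

data Block : Set where
  blkα blkβ blkγ : Block

blockOf : ℕ → ℕ → Block
blockOf d i = if i <ᵇ lenA d then blkα else (if i <ᵇ lenA d + lenB d then blkβ else blkγ)

concatVertex : (d : ℕ) → Bool → Bool → Bool → Vertex d
concatVertex d x y z = tabulate λ (i : Fin d) → pick (blockOf d (toℕ i))
  where
  pick : Block → Bool
  pick blkα = x
  pick blkβ = y
  pick blkγ = z

v₁ v₂ v₃ v₄ : (d : ℕ) → Vertex d
v₁ d = concatVertex d false false false
v₂ d = concatVertex d true true false
v₃ d = concatVertex d false true true
v₄ d = concatVertex d true false true

b2n : Bool → ℕ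
b2n true = 1
b2n false = 0

astCount : (d : ℕ) → Word d → ℕ
astCount d r = b2n (inAst (v₁ d) r) + b2n (inAst (v₂ d) r)
             + b2n (inAst (v₃ d) r) + b2n (inAst (v₄ d) r)

ridgesInExactly : (d k : ℕ) → ℕ
ridgesInExactly d k = length (filter (λ r → astCount d r ≟ k) (ridges d))

-- A ridge is a word with exactly two fixed letters, and it lies in Ast(v) iff v agrees
-- with both of them. On the blocks α, β, γ the four vertices v₁, v₂, v₃, v₄ read
-- 0101, 0110 and 0011: each of these columns has two 0s and two 1s, and two distinct
-- columns take every pair of values exactly once. So a ridge whose fixed letters lie in
-- different blocks is in exactly one asterisk, and a ridge with both fixed letters in one
-- block is in two of them if the letters agree and in none otherwise. Both kinds of
-- ridges are therefore counted by the ordered pairs of distinct positions inside a block,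
-- a(a-1) + b(b-1) + c(c-1), and substituting the block lengths gives the formulas.
module Submission where

open import Defs
open import Data.Nat using (ℕ; zero; suc; _+_; _*_; _∸_; _≤_; z≤n; s≤s; _≤?_; _<ᵇ_; _≡ᵇ_; _≟_; _%_; _/_)
open import Data.Nat.DivMod using (m≡m%n+[m/n]*n; m%n<n)
open import Data.Nat.Properties using (+-identityʳ; m≤m+n; m+n∸m≡n)
open import Data.Nat.Tactic.RingSolver using (solve-∀)
open import Data.Bool using (Bool; true; false; not; _∧_; if_then_else_)
open import Data.Bool.Properties using (T?)
open import Data.Fin using (Fin; toℕ)
open import Data.Vec using (Vec; []; _∷_; tabulate; map)
open import Data.Vec.Properties using (tabulate-cong; tabulate-∘)
open import Data.List using (List; []; _∷_; filter; length; concatMap; cartesianProduct)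
open import Data.Bool.ListAction using (all)
open import Data.List.Membership.Propositional using (_∈_)
open import Data.List.Membership.Propositional.Properties using (∈-cartesianProduct⁺)
open import Data.List.Relation.Unary.Any using (here; there)
open import Data.List.Relation.Unary.All as All using (all?)
open import Data.Product using (Σ; _×_; _,_; proj₁)
open import Function using (_∘_)
open import Relation.Nullary.Decidable using (Dec; True; toWitness)
open import Relation.Binary.PropositionalEquality

module _ {A : Set} where

  countᵇ : (A → Bool) → List A → ℕ
  countᵇ p []       = 0
  countᵇ p (x ∷ xs) = b2n (p x) + countᵇ p xs

  countᵇ-cong : {p q : A → Bool} → (∀ x → p x ≡ q x) → ∀ xs → countᵇ p xs ≡ countᵇ q xs
  countᵇ-cong p≗q []       = refl
  countᵇ-cong p≗q (x ∷ xs) = cong₂ _+_ (cong b2n (p≗q x)) (countᵇ-cong p≗q xs)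

  countᵇ-false : ∀ xs → countᵇ (λ _ → false) xs ≡ 0
  countᵇ-false []       = refl
  countᵇ-false (x ∷ xs) = countᵇ-false xs

  length-filter-filter : (p : A → Bool) (f : A → ℕ) (k : ℕ) (xs : List A) →
    length (filter (λ x → f x ≟ k) (filter (T? ∘ p) xs)) ≡ countᵇ (λ x → p x ∧ (f x ≡ᵇ k)) xs
  length-filter-filter p f k [] = refl
  length-filter-filter p f k (x ∷ xs) with p x
  ... | false = length-filter-filter p f k xs
  ... | true with f x ≡ᵇ k
  ...   | true  = cong suc (length-filter-filter p f k xs)
  ...   | false = length-filter-filter p f k xs

  module _ {xs : List A} (∈-xs : ∀ x → x ∈ xs) where

    byExhaustion : {P : A → A → Set} (P? : ∀ x y → Dec (P x y)) →
      True (all? (λ x → all? (P? x) xs) xs) → ∀ x y → P x y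
    byExhaustion P? ok x y = All.lookup (All.lookup (toWitness ok) (∈-xs x)) (∈-xs y)

+-interchange₃ : ∀ a b c x y z → a + (b + (c + (x + y + z))) ≡ (a + x) + (b + y) + (c + z)
+-interchange₃ = solve-∀

countᵇ-allWords-suc : ∀ d (p : Word (suc d) → Bool) →
  countᵇ p (allWords (suc d)) ≡
  countᵇ (p ∘ (𝟎 ∷_)) (allWords d) + countᵇ (p ∘ (𝟏 ∷_)) (allWords d) + countᵇ (p ∘ (X ∷_)) (allWords d)
countᵇ-allWords-suc d p = go (allWords d)
  where
  go : ∀ ws → countᵇ p (concatMap (λ w → (𝟎 ∷ w) ∷ (𝟏 ∷ w) ∷ (X ∷ w) ∷ []) ws) ≡
    countᵇ (p ∘ (𝟎 ∷_)) ws + countᵇ (p ∘ (𝟏 ∷_)) ws + countᵇ (p ∘ (X ∷_)) ws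
  go []       = refl
  go (w ∷ ws) rewrite go ws = +-interchange₃ (b2n (p (𝟎 ∷ w))) (b2n (p (𝟏 ∷ w))) (b2n (p (X ∷ w)))
    (countᵇ (p ∘ (𝟎 ∷_)) ws) (countᵇ (p ∘ (𝟏 ∷_)) ws) (countᵇ (p ∘ (X ∷_)) ws)

module _ {L : Set} where

  Entry : Set
  Entry = L × Bool

  fixedEntries : ∀ {d} → Vec L d → Word d → List Entry
  fixedEntries []       []      = []
  fixedEntries (l ∷ ls) (𝟎 ∷ w) = (l , false) ∷ fixedEntries ls w
  fixedEntries (l ∷ ls) (𝟏 ∷ w) = (l , true) ∷ fixedEntries ls w
  fixedEntries (l ∷ ls) (X ∷ w) = fixedEntries ls w

  numFixed-fixedEntries : ∀ {d} (ls : Vec L d) (w : Word d) → numFixed w ≡ length (fixedEntries ls w)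
  numFixed-fixedEntries []       []      = refl
  numFixed-fixedEntries (l ∷ ls) (𝟎 ∷ w) = cong suc (numFixed-fixedEntries ls w)
  numFixed-fixedEntries (l ∷ ls) (𝟏 ∷ w) = cong suc (numFixed-fixedEntries ls w)
  numFixed-fixedEntries (l ∷ ls) (X ∷ w) = numFixed-fixedEntries ls w

  agrees : (L → Bool) → Entry → Bool
  agrees f (l , true)  = f l
  agrees f (l , false) = not (f l)

  contains-map : ∀ {d} (f : L → Bool) (ls : Vec L d) (w : Word d) →
    contains w (map f ls) ≡ all (agrees f) (fixedEntries ls w)
  contains-map f []       []      = refl
  contains-map f (l ∷ ls) (X ∷ w) = contains-map f ls w
  contains-map f (l ∷ ls) (𝟎 ∷ w) with f l
  ... | false = contains-map f ls w
  ... | true  = refl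
  contains-map f (l ∷ ls) (𝟏 ∷ w) with f l
  ... | true  = contains-map f ls w
  ... | false = refl

  countWords : ∀ {d} → (List Entry → Bool) → Vec L d → ℕ
  countWords {d} Q ls = countᵇ (Q ∘ fixedEntries ls) (allWords d)

  countWords-∷ : ∀ {d} (Q : List Entry → Bool) l (ls : Vec L d) →
    countWords Q (l ∷ ls) ≡
    countWords (Q ∘ ((l , false) ∷_)) ls + countWords (Q ∘ ((l , true) ∷_)) ls + countWords Q ls
  countWords-∷ {d} Q l ls = countᵇ-allWords-suc d (Q ∘ fixedEntries (l ∷ ls))

  exactly₀ : Bool → List Entry → Bool
  exactly₀ c []      = c
  exactly₀ c (_ ∷ _) = false

  exactly₁ : (Entry → Bool) → List Entry → Bool
  exactly₁ φ []       = false
  exactly₁ φ (e ∷ es) = exactly₀ (φ e) es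

  exactly₂ : (Entry → Entry → Bool) → List Entry → Bool
  exactly₂ ψ []       = false
  exactly₂ ψ (e ∷ es) = exactly₁ (ψ e) es

  Σ⟨_⟩ : ∀ {n} → (L → ℕ) → Vec L n → ℕ
  Σ⟨ f ⟩ []       = 0
  Σ⟨ f ⟩ (l ∷ ls) = f l + Σ⟨ f ⟩ ls

  Σ-cong : ∀ {n} {f g : L → ℕ} → (∀ l → f l ≡ g l) → (ls : Vec L n) → Σ⟨ f ⟩ ls ≡ Σ⟨ g ⟩ ls
  Σ-cong f≗g []       = refl
  Σ-cong f≗g (l ∷ ls) = cong₂ _+_ (f≗g l) (Σ-cong f≗g ls)

  Σ-+ : ∀ {n} (f g : L → ℕ) (ls : Vec L n) → Σ⟨ (λ l → f l + g l) ⟩ ls ≡ Σ⟨ f ⟩ ls + Σ⟨ g ⟩ ls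
  Σ-+ f g []       = refl
  Σ-+ f g (l ∷ ls) rewrite Σ-+ f g ls = +-interchange₂ (f l) (g l) (Σ⟨ f ⟩ ls) (Σ⟨ g ⟩ ls)
    where
    +-interchange₂ : ∀ a b x y → a + b + (x + y) ≡ a + x + (b + y)
    +-interchange₂ = solve-∀

  pairSum : ∀ {n} → (L → L → ℕ) → Vec L n → ℕ
  pairSum w []       = 0
  pairSum w (l ∷ ls) = Σ⟨ w l ⟩ ls + pairSum w ls

  weight₁ : (Entry → Bool) → L → ℕ
  weight₁ φ l = b2n (φ (l , false)) + b2n (φ (l , true))

  weight₂ : (Entry → Entry → Bool) → L → L → ℕ
  weight₂ ψ l l′ = weight₁ (ψ (l , false)) l′ + weight₁ (ψ (l , true)) l′

  countWords-exactly₀ : ∀ {d} c (ls : Vec L d) → countWords (exactly₀ c) ls ≡ b2n c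
  countWords-exactly₀ c [] = +-identityʳ (b2n c)
  countWords-exactly₀ {suc d} c (l ∷ ls)
    rewrite countWords-∷ (exactly₀ c) l ls | countᵇ-false (allWords d) = countWords-exactly₀ c ls

  countWords-exactly₁ : ∀ {d} φ (ls : Vec L d) → countWords (exactly₁ φ) ls ≡ Σ⟨ weight₁ φ ⟩ ls
  countWords-exactly₁ φ [] = refl
  countWords-exactly₁ φ (l ∷ ls)
    rewrite countWords-∷ (exactly₁ φ) l ls
          | countWords-exactly₀ (φ (l , false)) ls | countWords-exactly₀ (φ (l , true)) ls
          | countWords-exactly₁ φ ls = refl

  countWords-exactly₂ : ∀ {d} ψ (w : L → L → ℕ) → (∀ l l′ → weight₂ ψ l l′ ≡ w l l′) →
    (ls : Vec L d) → countWords (exactly₂ ψ) ls ≡ pairSum w ls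
  countWords-exactly₂ ψ w weight₂≡w [] = refl
  countWords-exactly₂ ψ w weight₂≡w (l ∷ ls) = begin
    countWords (exactly₂ ψ) (l ∷ ls)
      ≡⟨ countWords-∷ (exactly₂ ψ) l ls ⟩
    countWords (exactly₁ (ψ (l , false))) ls + countWords (exactly₁ (ψ (l , true))) ls
      + countWords (exactly₂ ψ) ls
      ≡⟨ cong₂ _+_ (cong₂ _+_ (countWords-exactly₁ (ψ (l , false)) ls)
                               (countWords-exactly₁ (ψ (l , true)) ls))
                   (countWords-exactly₂ ψ w weight₂≡w ls) ⟩
    Σ⟨ weight₁ (ψ (l , false)) ⟩ ls + Σ⟨ weight₁ (ψ (l , true)) ⟩ ls + pairSum w ls
      ≡⟨ cong (_+ pairSum w ls) (sym (Σ-+ (weight₁ (ψ (l , false))) (weight₁ (ψ (l , true))) ls)) ⟩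
    Σ⟨ weight₂ ψ l ⟩ ls + pairSum w ls
      ≡⟨ cong (_+ pairSum w ls) (Σ-cong (weight₂≡w l) ls) ⟩
    Σ⟨ w l ⟩ ls + pairSum w ls ∎
    where open ≡-Reasoning

blocks : (d : ℕ) → Vec Block d
blocks d = tabulate (blockOf d ∘ toℕ)

select : Bool → Bool → Bool → Block → Bool
select x y z blkα = x
select x y z blkβ = y
select x y z blkγ = z

concatVertex-blocks : ∀ d x y z → concatVertex d x y z ≡ map (select x y z) (blocks d)
concatVertex-blocks d x y z = trans (tabulate-cong entry) (tabulate-∘ (select x y z) (blockOf d ∘ toℕ))
  where
  -- The witness is concatVertex's own tabulated function, whose block selector is local
  -- to its definition; naming the function lets 'with' expose the block it is applied to.
  entries : Σ (Fin d → Bool) λ f → concatVertex d x y z ≡ tabulate f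
  entries = _ , refl

  entry : ∀ i → proj₁ entries i ≡ select x y z (blockOf d (toℕ i))
  entry i with blockOf d (toℕ i)
  ... | blkα = refl
  ... | blkβ = refl
  ... | blkγ = refl

vertexHits : Bool → List (Block × Bool) → ℕ
vertexHits ridge es = hits (select false false false) + hits (select true true false)
                     + hits (select false true true) + hits (select true false true)
  where
  hits : (Block → Bool) → ℕ
  hits v = b2n (ridge ∧ all (agrees v) es)

astCount-vertexHits : ∀ d r → astCount d r ≡ vertexHits (isRidge r) (fixedEntries (blocks d) r)
astCount-vertexHits d r
  rewrite concatVertex-blocks d false false false | concatVertex-blocks d true true false
        | concatVertex-blocks d false true true | concatVertex-blocks d true false true
        | contains-map (select false false false) (blocks d) r | contains-map (select true true false) (blocks d) r
        | contains-map (select false true true) (blocks d) r | contains-map (select true false true) (blocks d) r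
        = refl

incidences : Block × Bool → Block × Bool → ℕ
incidences e e′ = vertexHits true (e ∷ e′ ∷ [])

hitExactly : ℕ → Block × Bool → Block × Bool → Bool
hitExactly k e e′ = incidences e e′ ≡ᵇ k

isRidge∧astCount≡ᵇ : ∀ d k r →
  isRidge r ∧ (astCount d r ≡ᵇ k) ≡ exactly₂ (hitExactly k) (fixedEntries (blocks d) r)
isRidge∧astCount≡ᵇ d k r
  rewrite astCount-vertexHits d r | numFixed-fixedEntries (blocks d) r
  with fixedEntries (blocks d) r
... | []            = refl
... | _ ∷ []        = refl
... | _ ∷ _ ∷ []    = refl
... | _ ∷ _ ∷ _ ∷ _ = refl

allBlocks : List Block
allBlocks = blkα ∷ blkβ ∷ blkγ ∷ []

∈-allBlocks : ∀ b → b ∈ allBlocks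
∈-allBlocks blkα = here refl
∈-allBlocks blkβ = there (here refl)
∈-allBlocks blkγ = there (there (here refl))

allBools : List Bool
allBools = false ∷ true ∷ []

∈-allBools : ∀ p → p ∈ allBools
∈-allBools false = here refl
∈-allBools true  = there (here refl)

allEntries : List (Block × Bool)
allEntries = cartesianProduct allBlocks allBools

∈-allEntries : ∀ e → e ∈ allEntries
∈-allEntries (b , p) = ∈-cartesianProduct⁺ {xs = allBlocks} {ys = allBools} (∈-allBlocks b) (∈-allBools p)

incidences≤2 : ∀ e e′ → incidences e e′ ≤ 2
incidences≤2 = byExhaustion ∈-allEntries (λ e e′ → incidences e e′ ≤? 2) _

same : Block → Block → ℕ
same blkα blkα = 1
same blkβ blkβ = 1
same blkγ blkγ = 1
same _    _    = 0

twiceSame : Block → Block → ℕ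
twiceSame b b′ = same b b′ + same b b′

weight₂-hitExactly₀ : ∀ b b′ → weight₂ (hitExactly 0) b b′ ≡ twiceSame b b′
weight₂-hitExactly₀ = byExhaustion ∈-allBlocks (λ b b′ → weight₂ (hitExactly 0) b b′ ≟ twiceSame b b′) _

weight₂-hitExactly₂ : ∀ b b′ → weight₂ (hitExactly 2) b b′ ≡ twiceSame b b′
weight₂-hitExactly₂ = byExhaustion ∈-allBlocks (λ b b′ → weight₂ (hitExactly 2) b b′ ≟ twiceSame b b′) _

astCount≤2 : ∀ d r → isRidge r ≡ true → astCount d r ≤ 2
astCount≤2 d r ridge
  rewrite astCount-vertexHits d r | numFixed-fixedEntries (blocks d) r
  with fixedEntries (blocks d) r | ridge
... | e ∷ e′ ∷ [] | _ = incidences≤2 e e′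

ridgesInExactly-pairSum : ∀ d k → (∀ b b′ → weight₂ (hitExactly k) b b′ ≡ twiceSame b b′) →
  ridgesInExactly d k ≡ pairSum twiceSame (blocks d)
ridgesInExactly-pairSum d k weight≡ = begin
  ridgesInExactly d k
    ≡⟨ length-filter-filter isRidge (astCount d) k (allWords d) ⟩
  countᵇ (λ r → isRidge r ∧ (astCount d r ≡ᵇ k)) (allWords d)
    ≡⟨ countᵇ-cong (isRidge∧astCount≡ᵇ d k) (allWords d) ⟩
  countWords (exactly₂ (hitExactly k)) (blocks d)
    ≡⟨ countWords-exactly₂ (hitExactly k) twiceSame weight≡ (blocks d) ⟩
  pairSum twiceSame (blocks d) ∎
  where open ≡-Reasoning

orderedPairs : ℕ → ℕ
orderedPairs n = n * (n ∸ 1)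

orderedPairs-suc : ∀ n → orderedPairs (suc n) ≡ n + n + orderedPairs n
orderedPairs-suc zero    = refl
orderedPairs-suc (suc n) = lemma n
  where
  lemma : ∀ n → suc (suc n) * suc n ≡ suc n + suc n + suc n * n
  lemma = solve-∀

occurrences : ∀ {n} → Block → Vec Block n → ℕ
occurrences b = Σ⟨ same b ⟩

pairSum-twiceSame : ∀ {n} (bs : Vec Block n) → pairSum twiceSame bs ≡
  orderedPairs (occurrences blkα bs) + orderedPairs (occurrences blkβ bs) + orderedPairs (occurrences blkγ bs)
pairSum-twiceSame [] = refl
pairSum-twiceSame (blkα ∷ bs)
  rewrite Σ-+ (same blkα) (same blkα) bs | pairSum-twiceSame bs | orderedPairs-suc (occurrences blkα bs) =
  move₁ (occurrences blkα bs) (pairs blkα) (pairs blkβ) (pairs blkγ)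
  where
  pairs : Block → ℕ
  pairs b = orderedPairs (occurrences b bs)
  move₁ : ∀ o x y z → o + o + (x + y + z) ≡ o + o + x + y + z
  move₁ = solve-∀
pairSum-twiceSame (blkβ ∷ bs)
  rewrite Σ-+ (same blkβ) (same blkβ) bs | pairSum-twiceSame bs | orderedPairs-suc (occurrences blkβ bs) =
  move₂ (occurrences blkβ bs) (pairs blkα) (pairs blkβ) (pairs blkγ)
  where
  pairs : Block → ℕ
  pairs b = orderedPairs (occurrences b bs)
  move₂ : ∀ o x y z → o + o + (x + y + z) ≡ x + (o + o + y) + z
  move₂ = solve-∀
pairSum-twiceSame (blkγ ∷ bs)
  rewrite Σ-+ (same blkγ) (same blkγ) bs | pairSum-twiceSame bs | orderedPairs-suc (occurrences blkγ bs) =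
  move₃ (occurrences blkγ bs) (pairs blkα) (pairs blkβ) (pairs blkγ)
  where
  pairs : Block → ℕ
  pairs b = orderedPairs (occurrences b bs)
  move₃ : ∀ o x y z → o + o + (x + y + z) ≡ x + y + (o + o + z)
  move₃ = solve-∀

layout : ℕ → ℕ → ℕ → Block
layout a b i = if i <ᵇ a then blkα else (if i <ᵇ b then blkβ else blkγ)

occurrences-layout : ∀ {n} a b → a ≤ b → b ≤ n →
  let bs = tabulate {n = n} (layout a b ∘ toℕ) in
  occurrences blkα bs ≡ a × occurrences blkβ bs ≡ b ∸ a × occurrences blkγ bs ≡ n ∸ b
occurrences-layout {zero}  zero    zero    z≤n       z≤n       = refl , refl , refl
occurrences-layout {suc n} zero    zero    z≤n       z≤n       with occurrences-layout {n} 0 0 z≤n z≤n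
... | α , β , γ = α , β , cong suc γ
occurrences-layout {suc n} zero    (suc b) z≤n       (s≤s b≤n) with occurrences-layout {n} 0 b z≤n b≤n
... | α , β , γ = α , cong suc β , γ
occurrences-layout {suc n} (suc a) (suc b) (s≤s a≤b) (s≤s b≤n) with occurrences-layout a b a≤b b≤n
... | α , β , γ = cong suc α , β , γ

blockLengths-sum : ∀ d → lenA d + lenB d + lenC d ≡ d
blockLengths-sum d with d % 3 | m≡m%n+[m/n]*n d 3 | m%n<n d 3
... | 0 | d≡ | _ = trans (sum₀ (d / 3)) (sym d≡)
  where
  sum₀ : ∀ q → q + q + q ≡ 0 + q * 3
  sum₀ = solve-∀
... | 1 | d≡ | _ = trans (sum₁ (d / 3)) (sym d≡)
  where
  sum₁ : ∀ q → suc q + q + q ≡ 1 + q * 3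
  sum₁ = solve-∀
... | 2 | d≡ | _ = trans (sum₂ (d / 3)) (sym d≡)
  where
  sum₂ : ∀ q → suc q + suc q + q ≡ 2 + q * 3
  sum₂ = solve-∀
... | suc (suc (suc _)) | _ | s≤s (s≤s (s≤s ()))

blocks-occurrences : ∀ d →
  occurrences blkα (blocks d) ≡ lenA d × occurrences blkβ (blocks d) ≡ lenB d × occurrences blkγ (blocks d) ≡ lenC d
blocks-occurrences d =
  let α , β , γ = occurrences-layout (lenA d) (lenA d + lenB d) (m≤m+n (lenA d) (lenB d)) lenA+lenB≤d
  in α , trans β (m+n∸m≡n (lenA d) (lenB d)) , trans γ d∸[lenA+lenB]≡lenC
  where
  lenA+lenB≤d : lenA d + lenB d ≤ d
  lenA+lenB≤d = subst (lenA d + lenB d ≤_) (blockLengths-sum d) (m≤m+n (lenA d + lenB d) (lenC d))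

  d∸[lenA+lenB]≡lenC : d ∸ (lenA d + lenB d) ≡ lenC d
  d∸[lenA+lenB]≡lenC = trans (cong (_∸ (lenA d + lenB d)) (sym (blockLengths-sum d))) (m+n∸m≡n (lenA d + lenB d) (lenC d))

blockPairs : ℕ → ℕ
blockPairs d = orderedPairs (lenA d) + orderedPairs (lenB d) + orderedPairs (lenC d)

ridgesInExactly-blockPairs : ∀ d k → (∀ b b′ → weight₂ (hitExactly k) b b′ ≡ twiceSame b b′) →
  ridgesInExactly d k ≡ blockPairs d
ridgesInExactly-blockPairs d k weight≡ =
  let α , β , γ = blocks-occurrences d
  in trans (ridgesInExactly-pairSum d k weight≡)
    (trans (pairSum-twiceSame (blocks d))
      (cong₂ _+_ (cong₂ _+_ (cong orderedPairs α) (cong orderedPairs β)) (cong orderedPairs γ)))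

quotient-form : ∀ d {r} → d % 3 ≡ r → d ≡ r + d / 3 * 3
quotient-form d d%3≡r = trans (m≡m%n+[m/n]*n d 3) (cong (_+ d / 3 * 3) d%3≡r)

blockPairs-mod0 : ∀ d → d % 3 ≡ 0 → 3 * blockPairs d ≡ d * (d ∸ 3)
blockPairs-mod0 d d%3≡0 rewrite d%3≡0 =
  trans (closedForm (d / 3)) (cong (λ n → n * (n ∸ 3)) (sym (quotient-form d d%3≡0)))
  where
  closedForm : ∀ q → 3 * (orderedPairs q + orderedPairs q + orderedPairs q) ≡ (q * 3) * (q * 3 ∸ 3)
  closedForm zero    = refl
  closedForm (suc m) = polynomial m
    where
    polynomial : ∀ m → 3 * (suc m * m + suc m * m + suc m * m) ≡ (3 + m * 3) * (m * 3)
    polynomial = solve-∀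

blockPairs-mod1 : ∀ d → d % 3 ≡ 1 → 3 * blockPairs d ≡ (d ∸ 1) * (d ∸ 2)
blockPairs-mod1 d d%3≡1 rewrite d%3≡1 =
  trans (closedForm (d / 3)) (cong (λ n → (n ∸ 1) * (n ∸ 2)) (sym (quotient-form d d%3≡1)))
  where
  closedForm : ∀ q → 3 * (orderedPairs (suc q) + orderedPairs q + orderedPairs q) ≡ (1 + q * 3 ∸ 1) * (1 + q * 3 ∸ 2)
  closedForm zero    = refl
  closedForm (suc m) = polynomial m
    where
    polynomial : ∀ m → 3 * (suc (suc m) * suc m + suc m * m + suc m * m) ≡ (3 + m * 3) * (2 + m * 3)
    polynomial = solve-∀

blockPairs-mod2 : ∀ d → d % 3 ≡ 2 → 3 * blockPairs d ≡ (d ∸ 1) * (d ∸ 2)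
blockPairs-mod2 d d%3≡2 rewrite d%3≡2 =
  trans (closedForm (d / 3)) (cong (λ n → (n ∸ 1) * (n ∸ 2)) (sym (quotient-form d d%3≡2)))
  where
  closedForm : ∀ q → 3 * (orderedPairs (suc q) + orderedPairs (suc q) + orderedPairs q) ≡ (2 + q * 3 ∸ 1) * (2 + q * 3 ∸ 2)
  closedForm zero    = refl
  closedForm (suc m) = polynomial m
    where
    polynomial : ∀ m → 3 * (suc (suc m) * suc m + suc (suc m) * suc m + suc m * m) ≡ (4 + m * 3) * (3 + m * 3)
    polynomial = solve-∀

-- The counts hold in every dimension.
lemma10 : (d : ℕ) → 4 ≤ d →
    ((r : Word d) → isRidge r ≡ true → astCount d r ≤ 2)
    × (d % 3 ≡ 0 → 3 * ridgesInExactly d 2 ≡ d * (d ∸ 3))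
    × (d % 3 ≡ 1 → 3 * ridgesInExactly d 2 ≡ (d ∸ 1) * (d ∸ 2))
    × (d % 3 ≡ 2 → 3 * ridgesInExactly d 2 ≡ (d ∸ 1) * (d ∸ 2))
    × (ridgesInExactly d 2 ≡ ridgesInExactly d 0)
lemma10 d _ =
    astCount≤2 d
  , (λ d%3≡0 → trans (cong (3 *_) exactly2) (blockPairs-mod0 d d%3≡0))
  , (λ d%3≡1 → trans (cong (3 *_) exactly2) (blockPairs-mod1 d d%3≡1))
  , (λ d%3≡2 → trans (cong (3 *_) exactly2) (blockPairs-mod2 d d%3≡2))
  , trans exactly2 (sym exactly0)
  where
  exactly0 : ridgesInExactly d 0 ≡ blockPairs d
  exactly0 = ridgesInExactly-blockPairs d 0 weight₂-hitExactly₀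

  exactly2 : ridgesInExactly d 2 ≡ blockPairs d
  exactly2 = ridgesInExactly-blockPairs d 2 weight₂-hitExactly₂
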